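{- Let $\mathcal B=\langle \mathcal B,\leq,\mathcal A,\mathcal E,\tilde\top,\tilde\bot,\tilde\Rightarrow,\tilde\wedge,\tilde\vee,\tilde\forall,\tilde\exists\rangle$ be a pseudo-Heyting algebra and $\mathcal B_C$ its completion by closed subsets (as described in the context). Then the function $a\mapsto C(\{a\})$ from $\mathcal B$ to $\mathcal B_C$ is a morphism of pseudo-Heyting algebras.
   Context: Pseudo-Heyting algebra: a structure with $\mathcal B$ a set, $\leq$ a relation on $\mathcal B$, $\mathcal A,\mathcal E\subseteq\wp(\mathcal B)$, $\tilde\top,\tilde\bot\in\mathcal B$, $\tilde\Rightarrow,\tilde\wedge,\tilde\vee:\mathcal B\times\mathcal B\to\mathcal B$, $\tilde\forall:\mathcal A\to\mathcal B$, $\tilde\exists:\mathcal E\to\mathcal B$, such that for all $a,b,c\in\mathcal B$, $A\in\mathcal A$, $E\in\mathcal E$: $\leq$ is reflexive and transitive; $a\leq\tilde\top$; $\tilde\bot\leq a$; $a\tilde\wedge b\leq a$; $a\tilde\wedge b\leq b$; if $c\leq a$ and $c\leq b$ then $c\leq a\tilde\wedge b$; $a\leq a\tilde\vee b$; $b\leq a\tilde\vee b$; if $a\leq c$ and $b\leq c$ then $a\tilde\vee b\leq c$; $\{a\tilde\Rightarrow e\mid e\in A\}$ and $\{e\tilde\Rightarrow a\mid e\in E\}$ are in $\mathcal A$; if $a\in A$ then $\tilde\forall A\leq a$; if $b\leq a$ for all $a\in A$ then $b\leq\tilde\forall A$; if $a\in E$ then $a\leq\tilde\exists E$; if $a\leq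 b$ for all $a\in E$ then $\tilde\exists E\leq b$; and $a\leq b\tilde\Rightarrow c$ iff $a\tilde\wedge b\leq c$. Closure: for $X\subseteq\mathcal B$, $u(X)=\{y\mid\forall x\in X,\ x\leq y\}$, $l(X)=\{y\mid\forall x\in X,\ y\leq x\}$, $C(X)=l(u(X))$; $X$ is closed if $C(X)=X$. The completion $\mathcal B_C=\langle \mathcal B_C,\leq_C,\mathcal A_C,\mathcal E_C,\tilde\top_C,\tilde\bot_C,\tilde\Rightarrow_C,\tilde\wedge_C,\tilde\vee_C,\tilde\forall_C,\tilde\exists_C\rangle$: $\mathcal B_C$ is the set of closed subsets of $\mathcal B$, $\leq_C$ is inclusion, $\mathcal A_C=\mathcal E_C=\wp(\mathcal B_C)$, $\tilde\bot_C=C(\{\tilde\bot\})$, $\tilde\top_C=C(\{\tilde\top\})$, $\tilde\wedge_C$ is intersection, $X\tilde\vee_C Y=C(X\cup Y)$, $\tilde\forall_C E=\bigcap E$, $\tilde\exists_C E=C(\bigcup E)$, $X\tilde\Rightarrow_C Y=\bigcap\{C(\{x\tilde\Rightarrow y\})\mid C(\{x\})\subseteq X,\ Y\subseteq C(\{y\})\}$. Morphism of pseudo-Heyting algebras $F:\mathcal B_1\to\mathcal B_2$: a function such that $x\leq_1 y$ iff $F(x)\leq_2 F(y)$; $F(A)\in\mathcal A_2$ for $A\in\mathcal A_1$ and $F(E)\in\mathcal E_2$ for $E\in\mathcal E_1$; $F(\tilde\top_1)=\tilde\top_2$, $F(\tilde\bot_1)=\tilde\bot_2$, $F(a\tilde\Rightarrow_1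 b)=F(a)\tilde\Rightarrow_2F(b)$, likewise for $\tilde\wedge,\tilde\vee$, and $F(\tilde\forall_1A)=\tilde\forall_2F(A)$, $F(\tilde\exists_1E)=\tilde\exists_2F(E)$. -}

module Defs where

open import Level using (Level; _⊔_; suc; 0ℓ)
open import Data.Product using (Σ; Σ-syntax; ∃; _×_; _,_; proj₁; proj₂)
open import Data.Sum using (_⊎_; inj₁; inj₂)
open import Data.Unit.Polymorphic using (⊤)
open import Relation.Binary.PropositionalEquality using (_≡_; refl)

record PseudoHeyting (ℓ : Level) : Set (suc ℓ) where
  infix 4 _≤_
  infixr 5 _⇒̃_
  infixr 6 _∨̃_
  infixr 7 _∧̃_
  field
    Carrier : Set ℓ
    _≤_     : Carrier → Carrier → Set ℓ
    𝒜       : (Carrier → Set ℓ) → Set ℓ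
    ℰ       : (Carrier → Set ℓ) → Set ℓ
    ⊤̃       : Carrier
    ⊥̃       : Carrier
    _⇒̃_     : Carrier → Carrier → Carrier
    _∧̃_     : Carrier → Carrier → Carrier
    _∨̃_     : Carrier → Carrier → Carrier
    ∀̃       : (A : Carrier → Set ℓ) → 𝒜 A → Carrier
    ∃̃       : (E : Carrier → Set ℓ) → ℰ E → Carrier
    ≤-refl   : ∀ {a} → a ≤ a
    ≤-trans  : ∀ {a b c} → a ≤ b → b ≤ c → a ≤ c
    ≤-⊤      : ∀ {a} → a ≤ ⊤̃
    ⊥-≤      : ∀ {a} → ⊥̃ ≤ a
    ∧-ˡ      : ∀ {a b} → a ∧̃ b ≤ a
    ∧-ʳ      : ∀ {a b} → a ∧̃ b ≤ b
    ∧-glb    : ∀ {a b c} → c ≤ a → c ≤ b → c ≤ a ∧̃ b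
    ∨-ˡ      : ∀ {a b} → a ≤ a ∨̃ b
    ∨-ʳ      : ∀ {a b} → b ≤ a ∨̃ b
    ∨-lub    : ∀ {a b c} → a ≤ c → b ≤ c → a ∨̃ b ≤ c
    ⇒-𝒜      : ∀ a (A : Carrier → Set ℓ) → 𝒜 A →
               𝒜 (λ x → Σ[ e ∈ Carrier ] (A e × x ≡ (a ⇒̃ e)))
    ⇒-ℰ      : ∀ a (E : Carrier → Set ℓ) → ℰ E →
               𝒜 (λ x → Σ[ e ∈ Carrier ] (E e × x ≡ (e ⇒̃ a)))
    ∀-lower  : ∀ (A : Carrier → Set ℓ) (p : 𝒜 A) a → A a → ∀̃ A p ≤ a
    ∀-glb    : ∀ (A : Carrier → Set ℓ) (p : 𝒜 A) b → (∀ a → A a → b ≤ a) → b ≤ ∀̃ A p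
    ∃-upper  : ∀ (E : Carrier → Set ℓ) (p : ℰ E) a → E a → a ≤ ∃̃ E p
    ∃-lub    : ∀ (E : Carrier → Set ℓ) (p : ℰ E) b → (∀ a → E a → a ≤ b) → ∃̃ E p ≤ b
    ⇒-adjˡ   : ∀ {a b c} → a ≤ b ⇒̃ c → a ∧̃ b ≤ c
    ⇒-adjʳ   : ∀ {a b c} → a ∧̃ b ≤ c → a ≤ b ⇒̃ c

-- Raw pseudo-Heyting signature (target side), with a setoid equality _≈_,
-- where subsets of the carrier are represented as small-indexed families
-- (I : Set ι) → (I → Carrier). (Used for the completion.)

record RawFamPHA (ι c e r p : Level) : Set (suc (ι ⊔ c ⊔ e ⊔ r ⊔ p)) where
  field
    Carrier : Set c
    _≈_     : Carrier → Carrier → Set e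
    _≤_     : Carrier → Carrier → Set r
    𝒜       : {I : Set ι} → (I → Carrier) → Set p
    ℰ       : {I : Set ι} → (I → Carrier) → Set p
    ⊤̃       : Carrier
    ⊥̃       : Carrier
    _⇒̃_     : Carrier → Carrier → Carrier
    _∧̃_     : Carrier → Carrier → Carrier
    _∨̃_     : Carrier → Carrier → Carrier
    ∀̃       : {I : Set ι} (f : I → Carrier) → 𝒜 f → Carrier
    ∃̃       : {I : Set ι} (f : I → Carrier) → ℰ f → Carrier

module _ {ℓ c e r p : Level} (B₁ : PseudoHeyting ℓ) (B₂ : RawFamPHA ℓ c e r p) where
  private
    module S = PseudoHeyting B₁
    module T = RawFamPHA B₂

  imageFam : (S.Carrier → T.Carrier) → (A : S.Carrier → Set ℓ) →
             Σ S.Carrier A → T.Carrier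
  imageFam F A (a , _) = F a

  record IsMorphism (F : S.Carrier → T.Carrier) : Set (suc ℓ ⊔ c ⊔ e ⊔ r ⊔ p) where
    field
      order-⇒  : ∀ x y → x S.≤ y → F x T.≤ F y
      order-⇐  : ∀ x y → F x T.≤ F y → x S.≤ y
      pres-𝒜   : ∀ (A : S.Carrier → Set ℓ) → S.𝒜 A → T.𝒜 (imageFam F A)
      pres-ℰ   : ∀ (E : S.Carrier → Set ℓ) → S.ℰ E → T.ℰ (imageFam F E)
      pres-⊤   : F S.⊤̃ T.≈ T.⊤̃
      pres-⊥   : F S.⊥̃ T.≈ T.⊥̃
      pres-⇒   : ∀ a b → F (a S.⇒̃ b) T.≈ (F a T.⇒̃ F b)
      pres-∧   : ∀ a b → F (a S.∧̃ b) T.≈ (F a T.∧̃ F b)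
      pres-∨   : ∀ a b → F (a S.∨̃ b) T.≈ (F a T.∨̃ F b)
      pres-∀   : ∀ (A : S.Carrier → Set ℓ) (q : S.𝒜 A) →
                 F (S.∀̃ A q) T.≈ T.∀̃ (imageFam F A) (pres-𝒜 A q)
      pres-∃   : ∀ (E : S.Carrier → Set ℓ) (q : S.ℰ E) →
                 F (S.∃̃ E q) T.≈ T.∃̃ (imageFam F E) (pres-ℰ E q)

module Closure {ℓ : Level} (B : PseudoHeyting ℓ) where
  open PseudoHeyting B

  Subset : Set (suc ℓ)
  Subset = Carrier → Set ℓ

  _⊆_ : Subset → Subset → Set ℓ
  X ⊆ Y = ∀ b → X b → Y b

  _≐_ : Subset → Subset → Set ℓ
  X ≐ Y = (X ⊆ Y) × (Y ⊆ X)

  ｛_｝ : Carrier → Subset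
  ｛ a ｝ = λ x → x ≡ a

  u : Subset → Subset
  u X y = ∀ x → X x → x ≤ y

  l : Subset → Subset
  l X y = ∀ x → X x → y ≤ x

  C : Subset → Subset
  C X = l (u X)

  IsClosed : Subset → Set ℓ
  IsClosed X = C X ≐ X

  ClosedSet : Set (suc ℓ)
  ClosedSet = Σ Subset IsClosed

  ⊆C : ∀ X → X ⊆ C X
  ⊆C X x x∈X y y∈u = y∈u x x∈X

  CC⊆C : ∀ X → C (C X) ⊆ C X
  CC⊆C X y h z z∈uX = h z (λ w w∈CX → w∈CX z z∈uX)

  C-closed : ∀ X → IsClosed (C X)
  C-closed X = CC⊆C X , ⊆C (C X)

  C-mono : ∀ {X Y} → X ⊆ Y → C X ⊆ C Y
  C-mono X⊆Y y h z z∈uY = h z (λ x x∈X → z∈uY x (X⊆Y x x∈X))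

  ⋂ : {I : Set ℓ} → (I → ClosedSet) → Subset
  ⋂ f b = ∀ i → proj₁ (f i) b

  ⋂-closed : {I : Set ℓ} (f : I → ClosedSet) → IsClosed (⋂ f)
  ⋂-closed f =
    (λ y h i → proj₁ (proj₂ (f i)) y (C-mono (λ b b∈ → b∈ i) y h)) , ⊆C (⋂ f)

  ⋃ : {I : Set ℓ} → (I → ClosedSet) → Subset
  ⋃ {I} f b = Σ[ i ∈ I ] proj₁ (f i) b

  closure : Subset → ClosedSet
  closure X = C X , C-closed X

  ⊤C ⊥C : ClosedSet
  ⊤C = closure ｛ ⊤̃ ｝
  ⊥C = closure ｛ ⊥̃ ｝

  _∩_ : Subset → Subset → Subset
  (X ∩ Y) b = X b × Y b

  ∩-closed : ∀ {X Y} → IsClosed X → IsClosed Y → IsClosed (X ∩ Y)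
  ∩-closed {X} {Y} cX cY =
    (λ y h → proj₁ cX y (C-mono (λ b b∈ → proj₁ b∈) y h)
           , proj₁ cY y (C-mono (λ b b∈ → proj₂ b∈) y h))
    , ⊆C (X ∩ Y)

  _∧C_ : ClosedSet → ClosedSet → ClosedSet
  (X , cX) ∧C (Y , cY) = X ∩ Y , ∩-closed cX cY

  _∨C_ : ClosedSet → ClosedSet → ClosedSet
  (X , _) ∨C (Y , _) = closure (λ b → X b ⊎ Y b)

  ∀C : {I : Set ℓ} → (I → ClosedSet) → ClosedSet
  ∀C f = ⋂ f , ⋂-closed f

  ∃C : {I : Set ℓ} → (I → ClosedSet) → ClosedSet
  ∃C f = closure (⋃ f)

  _⇒C_ : ClosedSet → ClosedSet → ClosedSet
  (X , _) ⇒C (Y , _) =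
    ∀C {I = Σ[ x ∈ Carrier ] Σ[ y ∈ Carrier ] (C ｛ x ｝ ⊆ X × Y ⊆ C ｛ y ｝)}
       (λ { (x , y , _) → closure ｛ x ⇒̃ y ｝ })

  completion : RawFamPHA ℓ (suc ℓ) ℓ ℓ 0ℓ
  completion = record
    { Carrier = ClosedSet
    ; _≈_     = λ X Y → proj₁ X ≐ proj₁ Y
    ; _≤_     = λ X Y → proj₁ X ⊆ proj₁ Y
    ; 𝒜       = λ _ → ⊤
    ; ℰ       = λ _ → ⊤
    ; ⊤̃       = ⊤C
    ; ⊥̃       = ⊥C
    ; _⇒̃_     = _⇒C_
    ; _∧̃_     = _∧C_
    ; _∨̃_     = _∨C_
    ; ∀̃       = λ f _ → ∀C f
    ; ∃̃       = λ f _ → ∃C f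
    }

  principal : Carrier → ClosedSet
  principal a = closure ｛ a ｝

{-# OPTIONS --safe #-}
-- C ｛ a ｝ is exactly the down-set of a, so the embedding reflects and
-- preserves the order. Finite and infinite meets of down-sets are down-sets
-- of meets, and the closure of a set with a least upper bound s is the
-- down-set of s, which handles joins and existentials. For implication,
-- a ⇒̃ b lies below every x ⇒̃ y with x ≤ a and b ≤ y, so the defining
-- intersection is attained at (a , b).
module Submission where

open import Level using (Level)
open import Data.Product using (_,_; proj₁)
open import Data.Sum using (_⊎_; inj₁; inj₂)
open import Relation.Binary.PropositionalEquality using (refl)
open import Defs

module Embedding {ℓ : Level} (B : PseudoHeyting ℓ) where
  open PseudoHeyting B
  open Closure B

  ⇒-mono : ∀ {a b x y} → x ≤ a → b ≤ y → a ⇒̃ b ≤ x ⇒̃ y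
  ⇒-mono x≤a b≤y =
    ⇒-adjʳ (≤-trans (∧-glb ∧-ˡ (≤-trans ∧-ʳ x≤a))
                    (≤-trans (⇒-adjˡ ≤-refl) b≤y))

  ∈C｛｝⇒≤ : ∀ {a y} → C ｛ a ｝ y → y ≤ a
  ∈C｛｝⇒≤ {a} y∈ = y∈ a (λ { _ refl → ≤-refl })

  ≤⇒∈C｛｝ : ∀ {a y} → y ≤ a → C ｛ a ｝ y
  ≤⇒∈C｛｝ y≤a z z∈u = ≤-trans y≤a (z∈u _ refl)

  a∈C｛a｝ : ∀ {a} → C ｛ a ｝ a
  a∈C｛a｝ = ≤⇒∈C｛｝ ≤-refl

  C｛｝-mono : ∀ {a b} → a ≤ b → C ｛ a ｝ ⊆ C ｛ b ｝
  C｛｝-mono a≤b _ y∈ = ≤⇒∈C｛｝ (≤-trans (∈C｛｝⇒≤ y∈) a≤b)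

  C｛｝-reflects : ∀ {a b} → C ｛ a ｝ ⊆ C ｛ b ｝ → a ≤ b
  C｛｝-reflects a⊆b = ∈C｛｝⇒≤ (a⊆b _ a∈C｛a｝)

  C｛lub｝≐C : ∀ {X s} → u X s → C X s → C ｛ s ｝ ≐ C X
  C｛lub｝≐C s∈uX s∈CX =
      (λ y y∈ z z∈uX → ≤-trans (∈C｛｝⇒≤ y∈) (s∈CX z z∈uX))
    , (λ y y∈CX → ≤⇒∈C｛｝ (y∈CX _ s∈uX))

  principal-pres-∨ : ∀ a b → C ｛ a ∨̃ b ｝ ≐ proj₁ (principal a ∨C principal b)
  principal-pres-∨ a b = C｛lub｝≐C upper least
    where
    upper : u (λ y → C ｛ a ｝ y ⊎ C ｛ b ｝ y) (a ∨̃ b)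
    upper _ (inj₁ y∈) = ≤-trans (∈C｛｝⇒≤ y∈) ∨-ˡ
    upper _ (inj₂ y∈) = ≤-trans (∈C｛｝⇒≤ y∈) ∨-ʳ

    least : C (λ y → C ｛ a ｝ y ⊎ C ｛ b ｝ y) (a ∨̃ b)
    least z z∈u = ∨-lub (z∈u a (inj₁ a∈C｛a｝)) (z∈u b (inj₂ a∈C｛a｝))

  principal-pres-∃ : ∀ (E : Subset) (q : ℰ E) →
    C ｛ ∃̃ E q ｝ ≐ proj₁ (∃C (imageFam B completion principal E))
  principal-pres-∃ E q = C｛lub｝≐C upper least
    where
    upper : u (⋃ (imageFam B completion principal E)) (∃̃ E q)
    upper _ ((a , a∈E) , y∈) = ≤-trans (∈C｛｝⇒≤ y∈) (∃-upper E q a a∈E)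

    least : C (⋃ (imageFam B completion principal E)) (∃̃ E q)
    least z z∈u = ∃-lub E q z (λ a a∈E → z∈u a ((a , a∈E) , a∈C｛a｝))

  principal-pres-∧ : ∀ a b → C ｛ a ∧̃ b ｝ ≐ (C ｛ a ｝ ∩ C ｛ b ｝)
  principal-pres-∧ a b =
      (λ _ y∈ → C｛｝-mono ∧-ˡ _ y∈ , C｛｝-mono ∧-ʳ _ y∈)
    , (λ _ (y∈a , y∈b) → ≤⇒∈C｛｝ (∧-glb (∈C｛｝⇒≤ y∈a) (∈C｛｝⇒≤ y∈b)))

  principal-pres-∀ : ∀ (A : Subset) (q : 𝒜 A) →
    C ｛ ∀̃ A q ｝ ≐ ⋂ (imageFam B completion principal A)
  principal-pres-∀ A q =
      (λ _ y∈ (a , a∈A) → C｛｝-mono (∀-lower A q a a∈A) _ y∈)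
    , (λ y y∈⋂ → ≤⇒∈C｛｝ (∀-glb A q y (λ a a∈A → ∈C｛｝⇒≤ (y∈⋂ (a , a∈A)))))

  principal-pres-⇒ : ∀ a b →
    C ｛ a ⇒̃ b ｝ ≐ proj₁ (principal a ⇒C principal b)
  principal-pres-⇒ a b =
      (λ _ y∈ (x , y , x⊆a , b⊆y) →
         C｛｝-mono (⇒-mono (C｛｝-reflects x⊆a) (C｛｝-reflects b⊆y)) _ y∈)
    , (λ _ y∈⋂ → y∈⋂ (a , b , (λ _ z∈ → z∈) , (λ _ z∈ → z∈)))

  principal-isMorphism : IsMorphism B completion principal
  principal-isMorphism = record
    { order-⇒ = λ _ _ → C｛｝-mono
    ; order-⇐ = λ _ _ → C｛｝-reflects
    ; pres-𝒜  = λ _ _ → _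
    ; pres-ℰ  = λ _ _ → _
    ; pres-⊤  = (λ _ y∈ → y∈) , (λ _ y∈ → y∈)
    ; pres-⊥  = (λ _ y∈ → y∈) , (λ _ y∈ → y∈)
    ; pres-⇒  = principal-pres-⇒
    ; pres-∧  = principal-pres-∧
    ; pres-∨  = principal-pres-∨
    ; pres-∀  = principal-pres-∀
    ; pres-∃  = principal-pres-∃
    }

mainTheorem12 : {ℓ : Level} (B : PseudoHeyting ℓ) →
    IsMorphism B (Closure.completion B) (Closure.principal B)
mainTheorem12 B = Embedding.principal-isMorphism B
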